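{- Let $\mathfrak{h}=\bigoplus_{i\in I}\mathfrak{h}^i$ be a Hoffman graph where each $\mathfrak{h}^i$ is non-empty and indecomposable. Then: (1) for $\psi\in\mathrm{Aut}^*(\mathfrak{h})$, we have $(\psi|_{V(\mathfrak{h}^i)})_{i\in I}\in\mathcal{A}(\mathfrak{h})$; (2) for $(\psi^i)_{i\in I}\in\mathcal{A}(\mathfrak{h})$, the map $\psi:V(\mathfrak{h})\to V(\mathfrak{h})$ defined by $\psi(x)=\psi^i(x)$ whenever $x\in V(\mathfrak{h}^i)$ belongs to $\mathrm{Aut}^*(\mathfrak{h})$; (3) the map $\varphi:\mathrm{Aut}^*(\mathfrak{h})\to\mathcal{A}(\mathfrak{h})$, $\varphi(\psi)=(\psi|_{V(\mathfrak{h}^i)})_{i\in I}$, is bijective.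
   Context: A Hoffman graph $\mathfrak{h}=(H,\mu)$ is a finite simple graph $H$ with labeling $\mu:V(H)\to\{f,s\}$ such that every fat vertex (label $f$) has a slim neighbour (label $s$), and fat vertices are pairwise non-adjacent. $V_s,V_f$ denote slim/fat vertex sets, $N^f_{\mathfrak{h}}(x)$ fat neighbours of $x$. A Hoffman subgraph is an induced subgraph with restricted labeling; automorphisms are label-preserving graph automorphisms. $\mathrm{Aut}^*(\mathfrak{h})=\{\psi\in\mathrm{Aut}(\mathfrak{h}):\psi|_{V_s(\mathfrak{h})}=\mathrm{id}_{V_s(\mathfrak{h})}\}$. Sum: $\mathfrak{h}=\bigoplus_i\mathfrak{h}^i$ (Hoffman subgraphs) means (i) $V(\mathfrak{h})=\bigcup V(\mathfrak{h}^i)$; (ii) $V_s(\mathfrak{h})$ is the disjoint union of the $V_s(\mathfrak{h}^i)$; (iii) $N^f_{\mathfrak{h}^i}(x)=N^f_{\mathfrak{h}}(x)$ for $x\in V_s(\mathfrak{h}^i)$; (iv) for slim $x\in\mathfrak{h}^i$, $y\in\mathfrak{h}^j$, $i\ne j$: $|N^f_{\mathfrak{h}}(x)\cap N^f_{\mathfrak{h}}(y)|\le1$ with equality iff $x,y$ adjacent. Indecomposable: not a sum of two non-empty Hoffman subgraphs. For such a decomposition, $\mathcal{A}(\mathfrak{h})=\{(\psi^i)_{i\in I}\in\prod_{i\in I}\mathrm{Aut}^*(\mathfrak{h}^i):\psi^i(x)=\psi^j(x)$ for all $i\ne j$ in $I$ and all $x\in V_f(\mathfrak{h}^i)\cap V_f(\mathfrak{h}^j)\}$.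 -}

module Defs where

open import Data.Nat using (ℕ; _≤_)
open import Data.Fin using (Fin)
open import Data.Bool using (Bool; true; false; T; _∧_)
open import Data.List using (List; length; filterᵇ)
open import Data.Product using (Σ; _×_; _,_; proj₁; proj₂; ∃)
open import Data.Unit using (tt)
open import Relation.Binary.PropositionalEquality using (_≡_; _≢_)
open import Relation.Nullary using (¬_)
import Data.List.Base as L

data Label : Set where
  fat slim : Label

isFat : Label → Bool
isFat fat  = true
isFat slim = false

record HoffmanGraph : Set where
  field
    n      : ℕ
    adj    : Fin n → Fin n → Bool
    label  : Fin n → Label
    symm   : ∀ x y → adj x y ≡ adj y x
    irrefl : ∀ x → adj x x ≡ false
    fatIndep   : ∀ x y → label x ≡ fat → label y ≡ fat → adj x y ≡ false
    fatHasSlim : ∀ x → label x ≡ fat → Σ (Fin n) λ y → label y ≡ slim × adj x y ≡ true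

open HoffmanGraph public

-- Vertex subsets (describing induced Hoffman subgraphs) and their elements

VSet : ℕ → Set
VSet n = Fin n → Bool

full : ∀ {n} → VSet n
full _ = true

El : ∀ {n} → VSet n → Set
El {n} U = Σ (Fin n) λ x → T (U x)

val : ∀ {n} {U : VSet n} → El U → Fin n
val = proj₁

NonEmpty : ∀ {n} → VSet n → Set
NonEmpty {n} U = Σ (Fin n) λ x → T (U x)

IsHoffmanSubgraph : (h : HoffmanGraph) → VSet (n h) → Set
IsHoffmanSubgraph h U =
  ∀ x → T (U x) → label h x ≡ fat →
    Σ (Fin (n h)) λ y → T (U y) × label h y ≡ slim × adj h x y ≡ true

commonFat : (h : HoffmanGraph) → VSet (n h) → Fin (n h) → Fin (n h) → ℕ
commonFat h U x y =
  length (filterᵇ (λ z → U z ∧ isFat (label h z) ∧ adj h x z ∧ adj h y z) (L.allFin (n h)))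

-- The Hoffman subgraph on U is the sum of the Hoffman subgraphs on S i (i ∈ I)
-- (conditions (i)-(iv) of the definition, relative to the Hoffman graph on U;
--  for U = full this is the sum decomposition of h itself)

record IsSum (h : HoffmanGraph) (U : VSet (n h)) (I : Set) (S : I → VSet (n h)) : Set where
  field
    sub      : ∀ i x → T (S i x) → T (U x)
    hoffSub  : ∀ i → IsHoffmanSubgraph h (S i)
    -- (i) V = ⋃ V(h^i)
    cover    : ∀ x → T (U x) → Σ I λ i → T (S i x)
    -- (ii) slim vertex sets are pairwise disjoint (and cover V_s by (i))
    slimDisj : ∀ i j x → T (S i x) → T (S j x) → label h x ≡ slim → i ≡ j
    -- (iii) N^f_{h^i}(x) = N^f(x) for slim x in h^i
    fatNbrs  : ∀ i x y → T (S i x) → label h x ≡ slim →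
               T (U y) → label h y ≡ fat → adj h x y ≡ true → T (S i y)
    commonLe1 : ∀ i j → i ≢ j → ∀ x y → T (S i x) → T (S j y) →
                label h x ≡ slim → label h y ≡ slim → commonFat h U x y ≤ 1
    commonEq1⇒adj : ∀ i j → i ≢ j → ∀ x y → T (S i x) → T (S j y) →
                label h x ≡ slim → label h y ≡ slim → commonFat h U x y ≡ 1 → adj h x y ≡ true
    adj⇒commonEq1 : ∀ i j → i ≢ j → ∀ x y → T (S i x) → T (S j y) →
                label h x ≡ slim → label h y ≡ slim → adj h x y ≡ true → commonFat h U x y ≡ 1

Indecomposable : (h : HoffmanGraph) → VSet (n h) → Set
Indecomposable h U =
  ¬ (Σ (Bool → VSet (n h)) λ S → IsSum h U Bool S × (∀ b → NonEmpty (S b)))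

record IsAut (h : HoffmanGraph) (U : VSet (n h)) (f : El U → El U) : Set where
  field
    inv      : El U → El U
    inv-r    : ∀ x → val (f (inv x)) ≡ val x
    inv-l    : ∀ x → val (inv (f x)) ≡ val x
    pres-adj : ∀ x y → adj h (val (f x)) (val (f y)) ≡ adj h (val x) (val y)
    pres-lab : ∀ x → label h (val (f x)) ≡ label h (val x)

record IsAutStar (h : HoffmanGraph) (U : VSet (n h)) (f : El U → El U) : Set where
  field
    isAut   : IsAut h U f
    fixSlim : ∀ x → label h (val x) ≡ slim → val (f x) ≡ val x

AutStar : (h : HoffmanGraph) → VSet (n h) → Set
AutStar h U = Σ (El U → El U) (IsAutStar h U)

AutStarH : HoffmanGraph → Set
AutStarH h = AutStar h full

InA : (h : HoffmanGraph) (I : Set) (S : I → VSet (n h)) →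
      ((i : I) → El (S i) → El (S i)) → Set
InA h I S ψ =
  ((i : I) → IsAutStar h (S i) (ψ i)) ×
  (∀ i j → i ≢ j → ∀ x (p : T (S i x)) (q : T (S j x)) → label h x ≡ fat →
     val (ψ i (x , p)) ≡ val (ψ j (x , q)))

𝒜 : (h : HoffmanGraph) (I : Set) (S : I → VSet (n h)) → Set
𝒜 h I S = Σ ((i : I) → El (S i) → El (S i)) (InA h I S)

MapsInto : (h : HoffmanGraph) (I : Set) (S : I → VSet (n h)) → (El {n h} full → El {n h} full) → Set
MapsInto h I S ψ = ∀ i x → T (S i x) → T (S i (val (ψ (x , tt))))

restrict : (h : HoffmanGraph) (I : Set) (S : I → VSet (n h)) (ψ : El {n h} full → El {n h} full) →
           MapsInto h I S ψ → (i : I) → El (S i) → El (S i)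
restrict h I S ψ m i (x , p) = val (ψ (x , tt)) , m i x p

-- A permutation of V(h) preserving adjacency and labels and fixing every slim
-- vertex ("slim-fixing") maps each summand V(hⁱ) into itself: a fat vertex of
-- hⁱ has a slim neighbour in hⁱ, which is fixed, and by condition (iii) every
-- fat neighbour of that slim vertex lies in hⁱ.  Such a permutation restricts
-- to an element of Aut* of every vertex set it preserves; this gives (1).
--
-- For (2), a compatible family (ψⁱ) agrees on every vertex lying in two
-- summands, so it glues to a map F with F x = ψⁱ x whenever x ∈ V(hⁱ).  The
-- crux is that F reflects summands (F y ∈ V(hⁱ) ⇒ y ∈ V(hⁱ)): the ψʲ-orbit of
-- y stays in V(hⁱ) once it has entered it, and, ψʲ being a permutation of a
-- finite set, the orbit returns to y.  From this F is injective and preserves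
-- adjacency; finiteness again makes F a permutation, hence F ∈ Aut*(h).
-- The bijectivity (3) is then immediate, since the summands cover V(h).
module Submission where

open import Defs
open import Data.Product using (Σ; ∃; _×_; _,_; proj₁; proj₂)
open import Data.Bool using (T; true; false)
open import Data.Bool.Properties using (T-irrelevant; ¬-not)
open import Data.Fin using (Fin; toℕ; _≟_)
open import Data.Fin.Properties using (pigeonhole)
open import Data.Nat using (ℕ; zero; suc; _+_)
open import Data.Nat.Properties using (n<1+n; +-suc; m≤n⇒∃[o]m+o≡n)
open import Data.Nat.GeneralisedArithmetic using (fold; fold-+)
open import Data.Sum using (_⊎_; inj₁; inj₂)
open import Data.Unit using (tt)
open import Function.Definitions using (Injective)
open import Relation.Nullary using (¬_; yes; no)
open import Relation.Nullary.Decidable using (decidable-stable; T?)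
open import Relation.Binary.PropositionalEquality
  using (_≡_; refl; sym; trans; cong; cong₂; subst; module ≡-Reasoning)

-- Finite dynamics.  Here  fold a φ k  is φ applied k times to a.

fold-cancel : ∀ {A : Set} {φ : A → A} → Injective _≡_ _≡_ φ →
              ∀ k {a b} → fold a φ k ≡ fold b φ k → a ≡ b
fold-cancel φ-inj zero    e = e
fold-cancel φ-inj (suc k) e = fold-cancel φ-inj k (φ-inj e)

periodic : ∀ {A : Set} {N : ℕ} (v : A → Fin N) → Injective _≡_ _≡_ v →
           (φ : A → A) → Injective _≡_ _≡_ φ → ∀ a → ∃ λ k → fold a φ (suc k) ≡ a
periodic {N = N} v v-inj φ φ-inj a
  with i , j , i<j , same ← pigeonhole (n<1+n N) (λ m → v (fold a φ (toℕ m)))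
  with d , i+1+d≡j ← m≤n⇒∃[o]m+o≡n i<j =
  d , sym (fold-cancel φ-inj (toℕ i) (begin
    fold a φ (toℕ i)                        ≡⟨ v-inj same ⟩
    fold a φ (toℕ j)                        ≡⟨ cong (fold a φ) (sym (trans (+-suc (toℕ i) d) i+1+d≡j)) ⟩
    fold a φ (toℕ i + suc d)                ≡⟨ fold-+ a φ (toℕ i) ⟩
    fold (fold a φ (suc d)) φ (toℕ i)       ∎))
  where open ≡-Reasoning

orbit-invariant : ∀ {A : Set} (φ : A → A) (P : A → Set) → (∀ b → P b → P (φ b)) →
                  ∀ a → P (φ a) → ∀ m → P (fold a φ (suc m))
orbit-invariant φ P closed a Pφa zero    = Pφa
orbit-invariant φ P closed a Pφa (suc m) = closed _ (orbit-invariant φ P closed a Pφa m)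

-- For a permutation φ of a finite type, a φ-invariant property of φ a holds
-- at a, because the orbit of a returns to a.
invariant-reflected : ∀ {A : Set} {N : ℕ} (v : A → Fin N) → Injective _≡_ _≡_ v →
  (φ : A → A) → Injective _≡_ _≡_ φ → (P : A → Set) → (∀ b → P b → P (φ b)) →
  ∀ a → P (φ a) → P a
invariant-reflected v v-inj φ φ-inj P closed a Pφa
  with k , returns ← periodic v v-inj φ φ-inj a =
  subst P returns (orbit-invariant φ P closed a Pφa k)

val-injective : ∀ {N} {U : VSet N} → Injective _≡_ _≡_ (val {U = U})
val-injective {x = x , p} {.x , q} refl = cong (x ,_) (T-irrelevant p q)

slim-or-fat : ∀ ℓ → ℓ ≡ slim ⊎ ℓ ≡ fat
slim-or-fat slim = inj₁ refl
slim-or-fat fat  = inj₂ refl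

module SlimFixingMaps (h : HoffmanGraph) where

  record SlimFixing (f : Fin (n h) → Fin (n h)) : Set where
    field
      pres-adj : ∀ x y → adj h (f x) (f y) ≡ adj h x y
      pres-lab : ∀ x → label h (f x) ≡ label h x
      fix-slim : ∀ x → label h x ≡ slim → f x ≡ x

  inverse-slimFixing : ∀ {f g} → (∀ x → f (g x) ≡ x) → SlimFixing f → SlimFixing g
  inverse-slimFixing {f} {g} fg sf = record
    { pres-adj = λ x y → trans (sym (pres-adj (g x) (g y))) (cong₂ (adj h) (fg x) (fg y))
    ; pres-lab = lab
    ; fix-slim = λ x x-slim → trans (sym (fix-slim (g x) (trans (lab x) x-slim))) (fg x) }
    where
      open SlimFixing sf
      lab : ∀ x → label h (g x) ≡ label h x
      lab x = trans (sym (pres-lab (g x))) (cong (label h) (fg x))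

  restrict-autStar : (U : VSet (n h)) (f g : Fin (n h) → Fin (n h)) →
    (∀ x → f (g x) ≡ x) → (∀ x → g (f x) ≡ x) → SlimFixing f →
    (f-in : ∀ x → T (U x) → T (U (f x))) → (∀ x → T (U x) → T (U (g x))) →
    IsAutStar h U (λ u → f (val u) , f-in (val u) (proj₂ u))
  restrict-autStar U f g fg gf sf f-in g-in = record
    { isAut = record
      { inv      = λ u → g (val u) , g-in (val u) (proj₂ u)
      ; inv-r    = λ u → fg (val u)
      ; inv-l    = λ u → gf (val u)
      ; pres-adj = λ u w → pres-adj (val u) (val w)
      ; pres-lab = λ u → pres-lab (val u) }
    ; fixSlim = λ u → fix-slim (val u) }
    where open SlimFixing sf

  module Underlying (ψ : AutStarH h) where
    open IsAutStar (proj₂ ψ)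
    open IsAut isAut

    f g : Fin (n h) → Fin (n h)
    f x = val (proj₁ ψ (x , tt))
    g x = val (inv (x , tt))

    fg : ∀ x → f (g x) ≡ x
    fg x = inv-r (x , tt)

    gf : ∀ x → g (f x) ≡ x
    gf x = inv-l (x , tt)

    f-slimFixing : SlimFixing f
    f-slimFixing = record
      { pres-adj = λ x y → pres-adj (x , tt) (y , tt)
      ; pres-lab = λ x → pres-lab (x , tt)
      ; fix-slim = λ x → fixSlim (x , tt) }

module Decomposition (h : HoffmanGraph) (I : Set) (S : I → VSet (n h))
                     (sum : IsSum h full I S) where
  open IsSum sum
  open SlimFixingMaps h

  home : Fin (n h) → I
  home x = proj₁ (cover x tt)

  in-home : ∀ x → T (S (home x) x)
  in-home x = proj₂ (cover x tt)

  slimFixing-preserves-summands : ∀ {f} → SlimFixing f → ∀ i x → T (S i x) → T (S i (f x))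
  slimFixing-preserves-summands {f} sf i x x∈i with slim-or-fat (label h x)
  ... | inj₁ x-slim = subst (λ z → T (S i z)) (sym (fix-slim x x-slim)) x∈i
    where open SlimFixing sf
  ... | inj₂ x-fat with y , y∈i , y-slim , xy ← hoffSub i x x∈i x-fat =
    fatNbrs i y (f x) y∈i y-slim tt (trans (pres-lab x) x-fat) y~fx
    where
      open SlimFixing sf
      open ≡-Reasoning
      y~fx : adj h y (f x) ≡ true
      y~fx = begin
        adj h y (f x)     ≡⟨ cong (λ z → adj h z (f x)) (sym (fix-slim y y-slim)) ⟩
        adj h (f y) (f x) ≡⟨ pres-adj y x ⟩
        adj h y x         ≡⟨ symm h y x ⟩
        adj h x y         ≡⟨ xy ⟩
        true              ∎

  module Restriction (ψ : AutStarH h) where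
    open Underlying ψ

    maps-into : MapsInto h I S (proj₁ ψ)
    maps-into = slimFixing-preserves-summands f-slimFixing

    restriction-in-𝒜 : InA h I S (restrict h I S (proj₁ ψ) maps-into)
    restriction-in-𝒜 =
      (λ i → restrict-autStar (S i) f g fg gf f-slimFixing (maps-into i)
               (slimFixing-preserves-summands (inverse-slimFixing fg f-slimFixing) i))
      , λ _ _ _ _ _ _ _ → refl

  module Gluing (a : 𝒜 h I S) where
    ψ : (i : I) → El (S i) → El (S i)
    ψ = proj₁ a

    open module ψAut (i : I) = IsAutStar (proj₁ (proj₂ a) i)
    open module ψIso (i : I) = IsAut (isAut i)

    ψ-injective : ∀ i → Injective _≡_ _≡_ (ψ i)
    ψ-injective i {u} {w} e = val-injective (begin
      val u               ≡⟨ sym (inv-l i u) ⟩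
      val (inv i (ψ i u)) ≡⟨ cong (λ z → val (inv i z)) e ⟩
      val (inv i (ψ i w)) ≡⟨ inv-l i w ⟩
      val w               ∎)
      where open ≡-Reasoning

    -- Equality of vertices is decidable, so it
    -- suffices to refute its negation, which makes i ≟ j unnecessary.
    agree : ∀ i j x (p : T (S i x)) (q : T (S j x)) → val (ψ i (x , p)) ≡ val (ψ j (x , q))
    agree i j x p q = decidable-stable (_ ≟ _) λ differ → differ (by-label differ)
      where
        by-label : ¬ val (ψ i (x , p)) ≡ val (ψ j (x , q)) → val (ψ i (x , p)) ≡ val (ψ j (x , q))
        by-label differ with slim-or-fat (label h x)
        ... | inj₁ x-slim = trans (fixSlim i (x , p) x-slim) (sym (fixSlim j (x , q) x-slim))
        ... | inj₂ x-fat  = proj₂ (proj₂ a) i j i≢j x p q x-fat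
          where
            i≢j : ¬ i ≡ j
            i≢j refl = differ (cong (λ r → val (ψ i (x , r))) (T-irrelevant p q))

    F : Fin (n h) → Fin (n h)
    F x = val (ψ (home x) (x , in-home x))

    F-agrees : ∀ i x (p : T (S i x)) → F x ≡ val (ψ i (x , p))
    F-agrees i x p = agree (home x) i x (in-home x) p

    F-stays : ∀ i x → T (S i x) → T (S i (F x))
    F-stays i x p = subst (λ z → T (S i z)) (sym (F-agrees i x p)) (proj₂ (ψ i (x , p)))

    -- F reflects summands: follow the ψʲ-orbit of y, which lies in S i from
    -- its first step on and returns to y.
    F-reflects : ∀ i y → T (S i (F y)) → T (S i y)
    F-reflects i y Fy∈i =
      invariant-reflected val val-injective (ψ j) (ψ-injective j) (λ b → T (S i (val b))) closed
        (y , in-home y) (subst (λ z → T (S i z)) (F-agrees j y (in-home y)) Fy∈i)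
      where
        j : I
        j = home y
        closed : ∀ b → T (S i (val b)) → T (S i (val (ψ j b)))
        closed (z , z∈j) z∈i =
          subst (λ w → T (S i w)) (agree i j z z∈i z∈j) (proj₂ (ψ i (z , z∈i)))

    -- If F x = F y then y lies in the summand of x, where F is the injective ψⁱ.
    F-injective : Injective _≡_ _≡_ F
    F-injective {x} {y} Fx≡Fy = cong val (ψ-injective i (val-injective (begin
      val (ψ i (x , x∈i)) ≡⟨ sym (F-agrees i x x∈i) ⟩
      F x                 ≡⟨ Fx≡Fy ⟩
      F y                 ≡⟨ F-agrees i y y∈i ⟩
      val (ψ i (y , y∈i)) ∎)))
      where
        open ≡-Reasoning
        i : I
        i = home x
        x∈i : T (S i x)
        x∈i = in-home x
        y∈i : T (S i y)
        y∈i = F-reflects i y (subst (λ z → T (S i z)) Fx≡Fy (F-stays i x x∈i))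

    F-lab : ∀ x → label h (F x) ≡ label h x
    F-lab x = pres-lab (home x) (x , in-home x)

    F-slim : ∀ x → label h x ≡ slim → F x ≡ x
    F-slim x = fixSlim (home x) (x , in-home x)

    adj-within : ∀ i x y → T (S i x) → T (S i y) → adj h (F x) (F y) ≡ adj h x y
    adj-within i x y p q =
      trans (cong₂ (adj h) (F-agrees i x p) (F-agrees i y q)) (pres-adj i (x , p) (y , q))

    adj-outside : ∀ i x z → T (S i x) → label h x ≡ slim → label h z ≡ fat →
                  ¬ T (S i z) → adj h x z ≡ false
    adj-outside i x z x∈i x-slim z-fat z∉i = ¬-not λ xz → z∉i (fatNbrs i x z x∈i x-slim tt z-fat xz)

    adj-slim-fat : ∀ x y → label h x ≡ slim → label h y ≡ fat → adj h (F x) (F y) ≡ adj h x y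
    adj-slim-fat x y x-slim y-fat with T? (S (home x) y)
    ... | yes y∈i = adj-within (home x) x y (in-home x) y∈i
    ... | no  y∉i = begin
      adj h (F x) (F y) ≡⟨ cong (λ z → adj h z (F y)) (F-slim x x-slim) ⟩
      adj h x (F y)     ≡⟨ adj-outside (home x) x (F y) (in-home x) x-slim (trans (F-lab y) y-fat)
                             (λ Fy∈i → y∉i (F-reflects (home x) y Fy∈i)) ⟩
      false             ≡⟨ sym (adj-outside (home x) x y (in-home x) x-slim y-fat y∉i) ⟩
      adj h x y         ∎
      where open ≡-Reasoning

    F-adj : ∀ x y → adj h (F x) (F y) ≡ adj h x y
    F-adj x y with slim-or-fat (label h x) | slim-or-fat (label h y)
    ... | inj₁ xs | inj₁ ys = cong₂ (adj h) (F-slim x xs) (F-slim y ys)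
    ... | inj₁ xs | inj₂ yf = adj-slim-fat x y xs yf
    ... | inj₂ xf | inj₁ ys =
      trans (symm h (F x) (F y)) (trans (adj-slim-fat y x ys xf) (symm h y x))
    ... | inj₂ xf | inj₂ yf =
      trans (fatIndep h (F x) (F y) (trans (F-lab x) xf) (trans (F-lab y) yf))
            (sym (fatIndep h x y xf yf))

    F-slimFixing : SlimFixing F
    F-slimFixing = record { pres-adj = F-adj ; pres-lab = F-lab ; fix-slim = F-slim }

    -- F is a permutation of the finite vertex set; its inverse runs around the cycle.
    F-cycle : ∀ w → ∃ λ k → fold w F (suc k) ≡ w
    F-cycle = periodic (λ z → z) (λ e → e) F F-injective

    G : Fin (n h) → Fin (n h)
    G w = fold w F (proj₁ (F-cycle w))

    FG : ∀ w → F (G w) ≡ w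
    FG w = proj₂ (F-cycle w)

    GF : ∀ x → G (F x) ≡ x
    GF x = F-injective (FG (F x))

    glued : AutStarH h
    glued = _ , restrict-autStar full F G FG GF F-slimFixing (λ _ _ → tt) (λ _ _ → tt)

    glued-extends : ∀ i x (p : T (S i x)) → val (proj₁ glued (x , tt)) ≡ val (ψ i (x , p))
    glued-extends = F-agrees

lemma5p6 : (h : HoffmanGraph) (I : Set) (S : I → VSet (n h)) →
    IsSum h full I S → (∀ i → NonEmpty (S i)) → (∀ i → Indecomposable h (S i)) →
    ((ψ : AutStarH h) → Σ (MapsInto h I S (proj₁ ψ)) λ m → InA h I S (restrict h I S (proj₁ ψ) m))
    × ((a : 𝒜 h I S) → Σ (AutStarH h) λ ψ →
    ∀ i x (p : T (S i x)) → val (proj₁ ψ (x , tt)) ≡ val (proj₁ a i (x , p)))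
    × (Σ (AutStarH h → 𝒜 h I S) λ φ →
    (∀ ψ i x (p : T (S i x)) → val (proj₁ (φ ψ) i (x , p)) ≡ val (proj₁ ψ (x , tt)))
    × (∀ ψ ψ' → (∀ i x (p : T (S i x)) → val (proj₁ (φ ψ) i (x , p)) ≡ val (proj₁ (φ ψ') i (x , p)))
    → ∀ (x : Fin (n h)) → val (proj₁ ψ (x , tt)) ≡ val (proj₁ ψ' (x , tt)))
    × (∀ (a : 𝒜 h I S) → Σ (AutStarH h) λ ψ →
    ∀ i x (p : T (S i x)) → val (proj₁ (φ ψ) i (x , p)) ≡ val (proj₁ a i (x , p))))
lemma5p6 h I S sum _ _ =
  restriction ,
  gluing ,
  ( φ
  , (λ _ _ _ _ → refl)
  , (λ _ _ same x → same (home x) x (in-home x))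
  , gluing )
  where
    open Decomposition h I S sum

    restriction : (ψ : AutStarH h) →
      Σ (MapsInto h I S (proj₁ ψ)) λ m → InA h I S (restrict h I S (proj₁ ψ) m)
    restriction ψ = maps-into , restriction-in-𝒜
      where open Restriction ψ

    gluing : (a : 𝒜 h I S) → Σ (AutStarH h) λ ψ →
      ∀ i x (p : T (S i x)) → val (proj₁ ψ (x , tt)) ≡ val (proj₁ a i (x , p))
    gluing a = glued , glued-extends
      where open Gluing a

    φ : AutStarH h → 𝒜 h I S
    φ ψ = restrict h I S (proj₁ ψ) (proj₁ (restriction ψ)) , proj₂ (restriction ψ)
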